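{- Let $G$ be a $d$-degenerate graph, let $s\ge 0$ be an integer and $p=2s+d+1$. Let $S=\{b'_1,\dots,b'_p\}$ be a set of $p$ distinct vertices of $G$ whose closed neighborhoods $N_G[b'_1],\dots,N_G[b'_p]$ are pairwise distinct and form a sunflower with core $C$. Then $S\setminus C$ is an independent set of $G$, $S\cap C$ is a clique in $G$, and $|S\setminus C|\ge 2s$.
   Context: All graphs are finite and simple; $N_G[v]$ denotes the closed neighborhood of $v$ (the vertex $v$ together with all its neighbours). A graph $G$ is $d$-degenerate if every induced subgraph of $G$ has a vertex of degree at most $d$. A family $\{P_1,\dots,P_p\}$ of non-empty sets is a sunflower with core $C$ (possibly empty) if $P_i\setminus C\neq\emptyset$ for every $i$ and $P_i\cap P_j=C$ for all $i\ne j$; the sets $P_i\setminus C$ are its petals. -}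

module Defs where

open import Data.Nat using (ℕ; _≤_)
open import Data.Fin using (Fin)
open import Data.Fin.Subset using (Subset; _∈_; _∉_; _∩_; _∪_; ⁅_⁆; ⋃; ∣_∣; Nonempty)
open import Data.List using (map; allFin)
open import Data.Product using (Σ; _×_; ∃)
open import Relation.Binary.PropositionalEquality using (_≡_; _≢_)
open import Relation.Nullary using (¬_)

record Graph (n : ℕ) : Set where
  field
    nbr    : Fin n → Subset n
    sym    : ∀ {x y} → y ∈ nbr x → x ∈ nbr y
    irrefl : ∀ {x} → x ∉ nbr x

open Graph public

Adj : ∀ {n} → Graph n → Fin n → Fin n → Set
Adj G x y = y ∈ nbr G x

N[_,_] : ∀ {n} → Graph n → Fin n → Subset n
N[ G , v ] = ⁅ v ⁆ ∪ nbr G v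

Degenerate : ∀ {n} → ℕ → Graph n → Set
Degenerate d G = ∀ U → Nonempty U → ∃ λ v → v ∈ U × ∣ nbr G v ∩ U ∣ ≤ d

IsSunflower : ∀ {n p} → (Fin p → Subset n) → Subset n → Set
IsSunflower {p = p} F C =
  (∀ i → Nonempty (F i)) ×
  (∀ i → ∃ λ x → x ∈ F i × x ∉ C) ×
  (∀ (i j : Fin p) → i ≢ j → F i ∩ F j ≡ C)

image : ∀ {n p} → (Fin p → Fin n) → Subset n
image {p = p} b = ⋃ (map (λ i → ⁅ b i ⁆) (allFin p))

Independent : ∀ {n} → Graph n → Subset n → Set
Independent G U = ∀ x y → x ∈ U → y ∈ U → ¬ Adj G x y

Clique : ∀ {n} → Graph n → Subset n → Set
Clique G U = ∀ x y → x ∈ U → y ∈ U → x ≢ y → Adj G x y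

-- The closed neighbourhood of a petal vertex b ∉ C contains b, so b lies in
-- no other N[b'] (else b ∈ C); hence petal vertices are pairwise
-- non-adjacent.  Every core vertex lies in every N[b'], so the vertices of
-- S ∩ C are pairwise adjacent.  A clique in a d-degenerate graph has at most
-- d + 1 vertices, which leaves at least p − (d + 1) = 2s vertices in S ∖ C.
module Submission where

open import Defs hiding (sym)
open import Data.Nat using (ℕ; zero; suc; _+_; _*_; _≤_; z≤n; s≤s)
open import Data.Nat.Properties
  using (≤-trans; ≤-reflexive; +-monoˡ-≤; +-cancelˡ-≤; +-suc; +-comm; +-assoc; module ≤-Reasoning)
open import Data.Fin using (Fin; zero; suc)
open import Data.Fin.Subset
  using (Subset; _∈_; _∉_; _⊆_; _∩_; _∪_; _─_; _-_; ⁅_⁆; ⋃; ∣_∣)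
open import Data.Fin.Subset.Properties
  using ( x∈p∩q⁺; x∈p∩q⁻; x∈p∪q⁺; x∈p∪q⁻; x∈⁅x⁆; x∈⁅y⁆⇒x≡y; ∉⊥; ∣⁅x⁆∣≡1; ∣⊥∣≡0
        ; ∣p∩q∣≤∣q∣; p⊆q⇒∣p∣≤∣q∣; p─q⊆p; x∈p∧x≢y⇒x∈p-y
        ; x∈p⇒∣p-x∣<∣p∣; nonempty?; Empty-unique )
open import Data.List using (tabulate)
open import Data.List.Properties using (map-tabulate)
open import Data.Vec using ([]; _∷_; here; there)
open import Data.Bool using (true; false)
open import Data.Product using (_×_; _,_; ∃; proj₁; proj₂)
open import Data.Sum using (inj₁; inj₂)
open import Function using (_∘_; id)
open import Relation.Nullary using (yes; no; contradiction)
open import Relation.Binary.PropositionalEquality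
  using (_≡_; _≢_; refl; sym; trans; cong; subst; module ≡-Reasoning)

private
  variable
    n k : ℕ

x∈p─q⇒x∉q : ∀ {x} {p q : Subset n} → x ∈ p ─ q → x ∉ q
x∈p─q⇒x∉q {p = true ∷ _} {false ∷ _} here         ()
x∈p─q⇒x∉q {p = _ ∷ _}    {_ ∷ _}     (there x∈p─q) (there x∈q) = x∈p─q⇒x∉q x∈p─q x∈q

∣p∣≡∣p∩q∣+∣p─q∣ : ∀ (p q : Subset n) → ∣ p ∣ ≡ ∣ p ∩ q ∣ + ∣ p ─ q ∣
∣p∣≡∣p∩q∣+∣p─q∣ []          []          = refl
∣p∣≡∣p∩q∣+∣p─q∣ (true ∷ p)  (true ∷ q)  = cong suc (∣p∣≡∣p∩q∣+∣p─q∣ p q)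
∣p∣≡∣p∩q∣+∣p─q∣ (true ∷ p)  (false ∷ q) =
  trans (cong suc (∣p∣≡∣p∩q∣+∣p─q∣ p q)) (sym (+-suc _ _))
∣p∣≡∣p∩q∣+∣p─q∣ (false ∷ p) (true ∷ q)  = ∣p∣≡∣p∩q∣+∣p─q∣ p q
∣p∣≡∣p∩q∣+∣p─q∣ (false ∷ p) (false ∷ q) = ∣p∣≡∣p∩q∣+∣p─q∣ p q

∣p∣≤1+∣p-x∣ : ∀ (p : Subset n) x → ∣ p ∣ ≤ suc ∣ p - x ∣
∣p∣≤1+∣p-x∣ p x = ≤-trans (≤-reflexive (∣p∣≡∣p∩q∣+∣p─q∣ p ⁅ x ⁆))
  (+-monoˡ-≤ ∣ p - x ∣ (≤-trans (∣p∩q∣≤∣q∣ p ⁅ x ⁆) (≤-reflexive (∣⁅x⁆∣≡1 x))))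

x∉p⇒∣p∣<∣⁅x⁆∪p∣ : ∀ {x} {p : Subset n} → x ∉ p → suc ∣ p ∣ ≤ ∣ ⁅ x ⁆ ∪ p ∣
x∉p⇒∣p∣<∣⁅x⁆∪p∣ {x = x} {p} x∉p =
  ≤-trans (s≤s (p⊆q⇒∣p∣≤∣q∣ p⊆⁅x⁆∪p-x)) (x∈p⇒∣p-x∣<∣p∣ (x∈p∪q⁺ (inj₁ (x∈⁅x⁆ x))))
  where
  p⊆⁅x⁆∪p-x : p ⊆ (⁅ x ⁆ ∪ p) - x
  p⊆⁅x⁆∪p-x y∈p = x∈p∧x≢y⇒x∈p-y (x∈p∪q⁺ (inj₂ y∈p)) λ { refl → x∉p y∈p }

image-suc : (b : Fin (suc k) → Fin n) → image b ≡ ⁅ b zero ⁆ ∪ image (b ∘ suc)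
image-suc b = begin
  image b                                      ≡⟨ image-tabulate b ⟩
  ⁅ b zero ⁆ ∪ ⋃ (tabulate (⁅_⁆ ∘ b ∘ suc))   ≡⟨ cong (⁅ b zero ⁆ ∪_) (image-tabulate (b ∘ suc)) ⟨
  ⁅ b zero ⁆ ∪ image (b ∘ suc)                 ∎
  where
  open ≡-Reasoning
  image-tabulate : ∀ {m} (c : Fin m → Fin n) → image c ≡ ⋃ (tabulate (⁅_⁆ ∘ c))
  image-tabulate c = cong ⋃ (map-tabulate id (⁅_⁆ ∘ c))

∈-image⁻ : ∀ (b : Fin k → Fin n) {x} → x ∈ image b → ∃ λ i → b i ≡ x
∈-image⁻ {k = zero}  b x∈ = contradiction x∈ ∉⊥
∈-image⁻ {k = suc k} b x∈ with x∈p∪q⁻ _ _ (subst (_ ∈_) (image-suc b) x∈)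
... | inj₁ x∈⁅b0⁆ = zero , sym (x∈⁅y⁆⇒x≡y _ x∈⁅b0⁆)
... | inj₂ x∈rest with ∈-image⁻ (b ∘ suc) x∈rest
...   | i , bi≡x = suc i , bi≡x

injective⇒∣image∣≥ : ∀ (b : Fin k → Fin n) → (∀ i j → i ≢ j → b i ≢ b j) → k ≤ ∣ image b ∣
injective⇒∣image∣≥ {k = zero}  b b-inj = z≤n
injective⇒∣image∣≥ {k = suc k} b b-inj = begin
  suc k                              ≤⟨ s≤s (injective⇒∣image∣≥ (b ∘ suc) tail-inj) ⟩
  suc ∣ image (b ∘ suc) ∣            ≤⟨ x∉p⇒∣p∣<∣⁅x⁆∪p∣ b0∉rest ⟩
  ∣ ⁅ b zero ⁆ ∪ image (b ∘ suc) ∣   ≡⟨ cong ∣_∣ (image-suc b) ⟨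
  ∣ image b ∣                        ∎
  where
  open ≤-Reasoning
  tail-inj : ∀ i j → i ≢ j → b (suc i) ≢ b (suc j)
  tail-inj i j i≢j = b-inj (suc i) (suc j) λ { refl → i≢j refl }
  b0∉rest : b zero ∉ image (b ∘ suc)
  b0∉rest b0∈ with ∈-image⁻ (b ∘ suc) b0∈
  ... | i , bi≡b0 = b-inj zero (suc i) (λ ()) (sym bi≡b0)

module _ {n} (G : Graph n) where

  v∈N[v] : ∀ v → v ∈ N[ G , v ]
  v∈N[v] v = x∈p∪q⁺ (inj₁ (x∈⁅x⁆ v))

  Adj⇒∈N : ∀ {v x} → Adj G v x → x ∈ N[ G , v ]
  Adj⇒∈N vx = x∈p∪q⁺ (inj₂ vx)

  ∈N⇒Adj : ∀ {v x} → x ∈ N[ G , v ] → x ≢ v → Adj G v x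
  ∈N⇒Adj x∈N x≢v with x∈p∪q⁻ _ _ x∈N
  ... | inj₁ x∈⁅v⁆ = contradiction (x∈⁅y⁆⇒x≡y _ x∈⁅v⁆) x≢v
  ... | inj₂ vx    = vx

  Degenerate⇒∣Clique∣≤1+d : ∀ {d U} → Degenerate d G → Clique G U → ∣ U ∣ ≤ suc d
  Degenerate⇒∣Clique∣≤1+d {d} {U} deg clique with nonempty? U
  ... | no U-empty = subst (_≤ suc d)
        (sym (trans (cong ∣_∣ (Empty-unique U-empty)) (∣⊥∣≡0 n))) z≤n
  ... | yes U-nonempty with deg U U-nonempty
  ...   | v , v∈U , deg-v≤d =
          ≤-trans (∣p∣≤1+∣p-x∣ U v) (s≤s (≤-trans (p⊆q⇒∣p∣≤∣q∣ U-v⊆nbr) deg-v≤d))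
    where
    U-v⊆nbr : U - v ⊆ nbr G v ∩ U
    U-v⊆nbr y∈U-v = x∈p∩q⁺
      ( clique v _ v∈U y∈U (λ { refl → x∈p─q⇒x∉q y∈U-v (x∈⁅x⁆ v) })
      , y∈U )
      where y∈U = p─q⊆p U ⁅ v ⁆ y∈U-v

module _ {F : Fin k → Subset n} {C : Subset n} (sunflower : IsSunflower F C) where

  private
    core : ∀ i j → i ≢ j → F i ∩ F j ≡ C
    core = proj₂ (proj₂ sunflower)

  sunflower-∩⊆core : ∀ {i j x} → i ≢ j → x ∈ F i → x ∈ F j → x ∈ C
  sunflower-∩⊆core {i} {j} i≢j x∈Fi x∈Fj =
    subst (_ ∈_) (core i j i≢j) (x∈p∩q⁺ (x∈Fi , x∈Fj))

  sunflower-core⊆ : ∀ {i j x} → i ≢ j → x ∈ C → x ∈ F i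
  sunflower-core⊆ {i} {j} i≢j x∈C =
    proj₁ (x∈p∩q⁻ _ _ (subst (_ ∈_) (sym (core i j i≢j)) x∈C))

module _ {n} (G : Graph n) (b : Fin k → Fin n) {C : Subset n}
         (sunflower : IsSunflower (λ i → N[ G , b i ]) C) where

  petals-independent : Independent G (image b ─ C)
  petals-independent x y x∈ y∈ xy
    with ∈-image⁻ b (p─q⊆p _ C x∈) | ∈-image⁻ b (p─q⊆p _ C y∈)
  ... | i , refl | j , refl = x∈p─q⇒x∉q x∈
    (sunflower-∩⊆core sunflower i≢j (v∈N[v] G (b i)) (Adj⇒∈N G (Graph.sym G xy)))
    where
    i≢j : i ≢ j
    i≢j refl = irrefl G xy

  core-clique : Clique G (image b ∩ C)
  core-clique x y x∈ y∈ x≢y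
    with ∈-image⁻ b (proj₁ (x∈p∩q⁻ _ _ x∈)) | ∈-image⁻ b (proj₁ (x∈p∩q⁻ _ _ y∈))
  ... | i , refl | j , refl = ∈N⇒Adj G
    (sunflower-core⊆ sunflower {i} {j} (λ { refl → x≢y refl }) (proj₂ (x∈p∩q⁻ _ _ y∈)))
    (x≢y ∘ sym)

lemma7 : ∀ {n} (G : Graph n) (d s : ℕ) → Degenerate d G →
    (b : Fin (2 * s + d + 1) → Fin n) →
    (∀ i j → i ≢ j → b i ≢ b j) →
    (∀ i j → i ≢ j → N[ G , b i ] ≢ N[ G , b j ]) →
    (C : Subset n) → IsSunflower (λ i → N[ G , b i ]) C →
    Independent G (image b ─ C) × Clique G (image b ∩ C) × 2 * s ≤ ∣ image b ─ C ∣
lemma7 G d s deg b b-inj _ C sunflower =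
  petals-independent G b sunflower , core-clique G b sunflower , petals-large
  where
  open ≤-Reasoning
  core-small : ∣ image b ∩ C ∣ ≤ suc d
  core-small = Degenerate⇒∣Clique∣≤1+d G deg (core-clique G b sunflower)
  petals-large : 2 * s ≤ ∣ image b ─ C ∣
  petals-large = +-cancelˡ-≤ (suc d) _ _ (begin
    suc d + 2 * s                          ≡⟨ +-comm (suc d) (2 * s) ⟩
    2 * s + suc d                          ≡⟨ cong (2 * s +_) (+-comm 1 d) ⟩
    2 * s + (d + 1)                        ≡⟨ +-assoc (2 * s) d 1 ⟨
    2 * s + d + 1                          ≤⟨ injective⇒∣image∣≥ b b-inj ⟩
    ∣ image b ∣                            ≡⟨ ∣p∣≡∣p∩q∣+∣p─q∣ (image b) C ⟩
    ∣ image b ∩ C ∣ + ∣ image b ─ C ∣      ≤⟨ +-monoˡ-≤ _ core-small ⟩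
    suc d + ∣ image b ─ C ∣                ∎)
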